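{- If $|\mathcal{O}|>1$ then $\mathrm{CTL}^*\mathrm{K}_m$ is strictly less expressive than $\mathrm{CTL}^*\mathrm{K}\Delta_m$, i.e. $\mathrm{CTL}^*\mathrm{K}_m\preceq\mathrm{CTL}^*\mathrm{K}\Delta_m$ and $\mathrm{CTL}^*\mathrm{K}\Delta_m\not\preceq\mathrm{CTL}^*\mathrm{K}_m$.
   Context: Agents $Ag=\{a_1,\dots,a_m\}$ with $m\ge1$, finite set $\mathcal{O}$ of observations. $\mathrm{CTL}^*\mathrm{K}\Delta_m$ formulas are history formulas $\varphi::=p\mid\neg\varphi\mid\varphi\wedge\varphi\mid A\psi\mid K_a\varphi\mid\Delta^{o}_a\varphi$ with path formulas $\psi::=\varphi\mid\neg\psi\mid\psi\wedge\psi\mid X\psi\mid\psi U\psi$; $\mathrm{CTL}^*\mathrm{K}_m$ is the fragment without the operators $\Delta^o_a$. Both are interpreted on multiagent Kripke structures with observations $M=(AP_f,S,T,V,\{\sim_o\}_{o\in\mathcal{O}},s_{\mathrm{init}},\vec o_{\mathrm{init}})$ (left-total $T$, equivalence relations $\sim_o$, an initial observation per agent) with the dynamic synchronous perfect-recall semantics: records $\vec r$ of observation changes $(o,n)$ per agent; agent $a$'s observations at time $n$ are $\mathrm{ol}_a(\vec r,n)$ (its previous observation followed by the changes made at time $n$, starting from $(\vec o_{\mathrm{init}})_a$); $h\sim^a_{\vec r}h'$ iff $|h|=|h'|$ and $h_i\sim_oh'_i$ for all $i<|h|$, $o\in\mathrm{ol}_a(\vec r,i)$; $K_a\varphi$ holds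 at $h,\vec r$ iff $\varphi$ holds at all $h'\sim^a_{\vec r}h$; $\Delta^o_a\varphi$ holds at $h,\vec r$ iff $\varphi$ holds at $h,\vec r\cdot(o,|h|-1)_a$; $A,X,U$ as in $\mathrm{CTL}^*$; $M\models\varphi$ iff $\varphi$ holds at history $s_{\mathrm{init}}$ with empty records. $\varphi\equiv\varphi'$ iff $M\models\varphi\Leftrightarrow M\models\varphi'$ for all models $M$; $L\preceq L'$ iff every formula of $L$ is equivalent to some formula of $L'$. -}

module Defs where

open import Data.Nat using (ℕ; zero; suc; _≤_; _<_; _≡ᵇ_)
open import Data.Fin using (Fin)
open import Data.Fin.Properties using () renaming (_≟_ to _≟ᶠ_)
open import Data.Bool using (Bool; true; false; if_then_else_)
open import Data.List using (List; []; _∷_; _++_; [_])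
open import Data.List.Membership.Propositional using (_∈_)
open import Data.Product using (_×_; _,_; ∃; Σ)
open import Data.Empty using (⊥)
open import Relation.Nullary using (¬_; does)
open import Relation.Binary.PropositionalEquality using (_≡_)
open import Relation.Binary.Structures using (IsEquivalence)
open import Function.Bundles using (_⇔_)

-- Agents are Fin m, observations are Fin k, atomic propositions are ℕ.

mutual
  data SF (m k : ℕ) : Set where
    atom : ℕ → SF m k
    neg  : SF m k → SF m k
    conj : SF m k → SF m k → SF m k
    A    : PF m k → SF m k
    K    : Fin m → SF m k → SF m k
    Δ    : Fin k → Fin m → SF m k → SF m k   -- Δ o a φ  =  Δ^o_a φ

  data PF (m k : ℕ) : Set where
    state : SF m k → PF m k
    negP  : PF m k → PF m k
    conjP : PF m k → PF m k → PF m k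
    X     : PF m k → PF m k
    U     : PF m k → PF m k → PF m k

-- CTL*K_m is the Δ-free fragment
mutual
  data NoΔ {m k : ℕ} : SF m k → Set where
    atom : ∀ p → NoΔ (atom p)
    neg  : ∀ {φ} → NoΔ φ → NoΔ (neg φ)
    conj : ∀ {φ φ'} → NoΔ φ → NoΔ φ' → NoΔ (conj φ φ')
    A    : ∀ {ψ} → NoΔP ψ → NoΔ (A ψ)
    K    : ∀ a {φ} → NoΔ φ → NoΔ (K a φ)

  data NoΔP {m k : ℕ} : PF m k → Set where
    state : ∀ {φ} → NoΔ φ → NoΔP (state φ)
    negP  : ∀ {ψ} → NoΔP ψ → NoΔP (negP ψ)
    conjP : ∀ {ψ ψ'} → NoΔP ψ → NoΔP ψ' → NoΔP (conjP ψ ψ')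
    X     : ∀ {ψ} → NoΔP ψ → NoΔP (X ψ)
    U     : ∀ {ψ ψ'} → NoΔP ψ → NoΔP ψ' → NoΔP (U ψ ψ')

record Model (m k : ℕ) : Set₁ where
  field
    AP       : List ℕ
    S        : Set
    T        : S → S → Set
    T-total  : ∀ s → ∃ λ s' → T s s'
    V        : S → ℕ → Bool
    V-AP     : ∀ s p → V s p ≡ true → p ∈ AP
    obs      : Fin k → S → S → Set
    obs-eq   : ∀ o → IsEquivalence (obs o)
    sinit    : S
    oinit    : Fin m → Fin k

-- a record assigns to each agent the (chronological) list of changes (o , n)
Record : ℕ → ℕ → Set
Record m k = Fin m → List (Fin k × ℕ)

emptyRec : ∀ {m k} → Record m k
emptyRec _ = []

extend : ∀ {m k} → Record m k → Fin m → Fin k → ℕ → Record m k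
extend r a o n b = if does (b ≟ᶠ a) then r b ++ [ (o , n) ] else r b

changesAt : ∀ {k} → List (Fin k × ℕ) → ℕ → List (Fin k)
changesAt [] n = []
changesAt ((o , t) ∷ r) n = if t ≡ᵇ n then o ∷ changesAt r n else changesAt r n

lastOr : ∀ {k} → Fin k → List (Fin k) → Fin k
lastOr d [] = d
lastOr d (o ∷ os) = lastOr o os

-- observation in force at the start of time n / at the end of time n
mutual
  startObs : ∀ {k} → Fin k → List (Fin k × ℕ) → ℕ → Fin k
  startObs oi r zero = oi
  startObs oi r (suc n) = endObs oi r n

  endObs : ∀ {k} → Fin k → List (Fin k × ℕ) → ℕ → Fin k
  endObs oi r n = lastOr (startObs oi r n) (changesAt r n)

ol : ∀ {m k} → Model m k → Record m k → Fin m → ℕ → List (Fin k)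
ol M r a n = startObs (Model.oinit M a) (r a) n ∷ changesAt (r a) n

-- Semantics.  A history of length n+1 is represented by (π , n) where
-- π : ℕ → S, and only π 0 … π n matter.

module _ {m k : ℕ} (M : Model m k) where
  open Model M

  IsPath : (ℕ → S) → Set
  IsPath π = ∀ i → T (π i) (π (suc i))

  IsHistory : (ℕ → S) → ℕ → Set
  IsHistory π n = π 0 ≡ sinit × (∀ i → i < n → T (π i) (π (suc i)))

  mutual
    sat : (π : ℕ → S) → ℕ → Record m k → SF m k → Set
    sat π n r (atom p)   = V (π n) p ≡ true
    sat π n r (neg φ)    = ¬ sat π n r φ
    sat π n r (conj φ ψ) = sat π n r φ × sat π n r ψ
    sat π n r (A ψ)      = ∀ (π' : ℕ → S) → IsPath π' →
                           (∀ i → i ≤ n → π' i ≡ π i) → satP π' n r ψ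
    sat π n r (K a φ)    = ∀ (π' : ℕ → S) → IsHistory π' n →
                           (∀ i → i ≤ n → ∀ o → o ∈ ol M r a i → obs o (π i) (π' i)) →
                           sat π' n r φ
    sat π n r (Δ o a φ)  = sat π n (extend r a o n) φ

    satP : (π : ℕ → S) → ℕ → Record m k → PF m k → Set
    satP π n r (state φ)   = sat π n r φ
    satP π n r (negP ψ)    = ¬ satP π n r ψ
    satP π n r (conjP ψ χ) = satP π n r ψ × satP π n r χ
    satP π n r (X ψ)       = satP π (suc n) r ψ
    satP π n r (U ψ χ)     = ∃ λ j → n ≤ j × satP π j r χ ×
                             (∀ i → n ≤ i → i < j → satP π i r ψ)

  _⊨_ : SF m k → Set
  _⊨_ φ = sat (λ _ → sinit) 0 emptyRec φ

_≋_ : ∀ {m k} → SF m k → SF m k → Set₁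
_≋_ {m} {k} φ φ' = (M : Model m k) → (_⊨_ M φ ⇔ _⊨_ M φ')

CTLK⪯CTLKΔ : ℕ → ℕ → Set₁
CTLK⪯CTLKΔ m k = ∀ (φ : SF m k) → NoΔ φ → Σ (SF m k) λ φ' → φ ≋ φ'

CTLKΔ⪯CTLK : ℕ → ℕ → Set₁
CTLKΔ⪯CTLK m k = ∀ (φ : SF m k) → Σ (SF m k) λ φ' → NoΔ φ' × φ ≋ φ'

module Submission where

-- Every CTL*K_m formula is in particular a CTL*KΔ_m formula,
-- equivalent to itself, which gives CTL*K_m ⪯ CTL*KΔ_m.  For strictness we
-- exhibit two models that no Δ-free formula distinguishes but a Δ-formula does.
--
-- The key observation is that, along the empty record, an agent only ever
-- uses its initial observation (ol M emptyRec a i = [ oinit a ]), and Δ-free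
-- formulas never extend the record.  Hence two models built on the same
-- underlying frame whose observation relations agree on the agents' initial
-- observations satisfy the same Δ-free formulas ('transfer').
--
-- The counterexample: states {false, true}, all transitions allowed, p true
-- exactly at 'true', initial state 'false', every agent initially observing
-- observation 0, which relates all states.  In the "blind" model every
-- observation relates all states; in the "sighted" model every other
-- observation identifies each state.  The formula
--     E X (p ∧ ¬ Δ^{1}_a K_a p)
-- (after switching to observation 1, agent a does not know p) holds in the
-- blind model and fails in the sighted one.

open import Defs
open import Data.Nat using (ℕ; zero; suc; _≤_; _<_; z≤n; s≤s; _≡ᵇ_)
open import Data.Fin using (Fin) renaming (zero to fzero; suc to fsuc)
open import Data.Bool using (Bool; true; false; _∧_)
open import Data.List using (List; []; _∷_)
open import Data.List.Relation.Unary.Any using (here; there)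
open import Data.List.Membership.Propositional using (_∈_)
open import Data.Product using (_×_; _,_; ∃)
open import Level using (0ℓ)
open import Relation.Nullary using (¬_)
open import Relation.Binary.PropositionalEquality
  using (_≡_; refl; subst; sym; cong; isEquivalence)
open import Relation.Binary.Structures using (IsEquivalence)
open import Relation.Binary.Construct.Always as Always using (Always)
open import Function.Bundles using (_⇔_; mk⇔; Equivalence)

≋-refl : ∀ {m k} (φ : SF m k) → φ ≋ φ
≋-refl φ M = mk⇔ (λ h → h) (λ h → h)

CTLK⪯CTLKΔ-holds : ∀ m k → CTLK⪯CTLKΔ m k
CTLK⪯CTLKΔ-holds m k φ _ = φ , ≋-refl φ

startObs-empty : ∀ {k} (oi : Fin k) n → startObs oi [] n ≡ oi
startObs-empty oi zero    = refl
startObs-empty oi (suc n) = startObs-empty oi n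

ol-empty : ∀ {m k} (M : Model m k) a n →
           ol M emptyRec a n ≡ Model.oinit M a ∷ []
ol-empty M a n = cong (_∷ []) (startObs-empty (Model.oinit M a) n)

record Frame (m k : ℕ) : Set₁ where
  field
    AP      : List ℕ
    S       : Set
    T       : S → S → Set
    T-total : ∀ s → ∃ λ s' → T s s'
    V       : S → ℕ → Bool
    V-AP    : ∀ s p → V s p ≡ true → p ∈ AP
    sinit   : S
    oinit   : Fin m → Fin k

record Observations {m k : ℕ} (F : Frame m k) : Set₁ where
  field
    obs    : Fin k → Frame.S F → Frame.S F → Set
    obs-eq : ∀ o → IsEquivalence (obs o)

withObs : ∀ {m k} (F : Frame m k) → Observations F → Model m k
withObs F O = record
  { AP = AP ; S = S ; T = T ; T-total = T-total ; V = V ; V-AP = V-AP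
  ; obs = obs ; obs-eq = obs-eq ; sinit = sinit ; oinit = oinit }
  where open Frame F; open Observations O

module _ {m k : ℕ} (F : Frame m k) where
  open Frame F
  open Observations

  AgreeInitially : Observations F → Observations F → Set
  AgreeInitially O O' = ∀ a s s' → obs O (oinit a) s s' ⇔ obs O' (oinit a) s s'

  agree-sym : ∀ O O' → AgreeInitially O O' → AgreeInitially O' O
  agree-sym O O' ag a s s' = mk⇔ (Equivalence.from (ag a s s')) (Equivalence.to (ag a s s'))

  mutual
    transfer : ∀ O O' → AgreeInitially O O' →
               ∀ (φ : SF m k) → NoΔ φ → ∀ π n →
               sat (withObs F O) π n emptyRec φ → sat (withObs F O') π n emptyRec φ
    transfer O O' ag _ (atom p) π n h = h
    transfer O O' ag _ (neg {φ} d) π n h h' =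
      h (transfer O' O (agree-sym O O' ag) φ d π n h')
    transfer O O' ag _ (conj {φ} {φ'} d d') π n (h , h') =
      transfer O O' ag φ d π n h , transfer O O' ag φ' d' π n h'
    transfer O O' ag _ (A {ψ} d) π n h π' path agrees =
      transferP O O' ag ψ d π' n (h π' path agrees)
    transfer O O' ag _ (K a {φ} d) π n h π' hist indist' =
      transfer O O' ag φ d π' n (h π' hist indist)
      where
      -- the only observation in force is the initial one, where O and O' agree
      indist : ∀ i → i ≤ n → ∀ o → o ∈ ol (withObs F O) emptyRec a i →
               obs O o (π i) (π' i)
      indist i i≤n o o∈ol with subst (o ∈_) (ol-empty (withObs F O) a i) o∈ol
      ... | here refl = Equivalence.from (ag a (π i) (π' i)) (indist' i i≤n o initial∈ol)
        where
        initial∈ol : oinit a ∈ ol (withObs F O') emptyRec a i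
        initial∈ol = subst (oinit a ∈_) (sym (ol-empty (withObs F O') a i)) (here refl)

    transferP : ∀ O O' → AgreeInitially O O' →
                ∀ (ψ : PF m k) → NoΔP ψ → ∀ π n →
                satP (withObs F O) π n emptyRec ψ → satP (withObs F O') π n emptyRec ψ
    transferP O O' ag _ (state {φ} d) π n h = transfer O O' ag φ d π n h
    transferP O O' ag _ (negP {ψ} d) π n h h' =
      h (transferP O' O (agree-sym O O' ag) ψ d π n h')
    transferP O O' ag _ (conjP {ψ} {ψ'} d d') π n (h , h') =
      transferP O O' ag ψ d π n h , transferP O O' ag ψ' d' π n h'
    transferP O O' ag _ (X {ψ} d) π n h = transferP O O' ag ψ d π (suc n) h
    transferP O O' ag _ (U {ψ} {ψ'} d d') π n (j , n≤j , hj , before) =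
      j , n≤j , transferP O O' ag ψ' d' π j hj ,
      λ i n≤i i<j → transferP O O' ag ψ d π i (before i n≤i i<j)

separation⇒¬CTLKΔ⪯CTLK : ∀ {m k} (M M' : Model m k) (φ : SF m k) →
  (∀ φ' → NoΔ φ' → _⊨_ M φ' → _⊨_ M' φ') →
  _⊨_ M φ → ¬ _⊨_ M' φ → ¬ CTLKΔ⪯CTLK m k
separation⇒¬CTLKΔ⪯CTLK M M' φ preserve M⊨φ M'⊭φ reduce
  with reduce φ
... | φ' , noΔ , φ≋φ' =
  M'⊭φ (Equivalence.from (φ≋φ' M')
         (preserve φ' noΔ (Equivalence.to (φ≋φ' M) M⊨φ)))

module TwoStates (m' k' : ℕ) where
  m k : ℕ
  m = suc m'
  k = suc (suc k')

  val : Bool → ℕ → Bool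
  val s p = s ∧ (p ≡ᵇ 0)

  val-AP : ∀ s p → val s p ≡ true → p ∈ 0 ∷ []
  val-AP true zero refl = here refl

  frame : Frame m k
  frame = record
    { AP = 0 ∷ [] ; S = Bool ; T = Always ; T-total = λ s → s , _
    ; V = val ; V-AP = val-AP ; sinit = false ; oinit = λ _ → fzero }

  blind : Observations frame
  blind = record { obs = λ _ → Always ; obs-eq = λ _ → Always.isEquivalence Bool 0ℓ }

  sightedObs : Fin k → Bool → Bool → Set
  sightedObs fzero    = Always
  sightedObs (fsuc _) = _≡_

  sighted : Observations frame
  sighted = record { obs = sightedObs ; obs-eq = obs-eq }
    where
    obs-eq : ∀ o → IsEquivalence (sightedObs o)
    obs-eq fzero    = Always.isEquivalence Bool 0ℓ
    obs-eq (fsuc _) = isEquivalence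

  blind-agrees-sighted : AgreeInitially frame blind sighted
  blind-agrees-sighted a s s' = mk⇔ (λ _ → _) (λ _ → _)

  agent : Fin m
  agent = fzero

  forgetsP : SF m k
  forgetsP = conj (atom 0) (neg (Δ (fsuc fzero) agent (K agent (atom 0))))

  -- E X forgetsP, written as ¬ A X ¬ forgetsP
  separating : SF m k
  separating = neg (A (X (state (neg forgetsP))))

  -- In the blind model, the path false, true, true, … witnesses E X forgetsP:
  -- the constant history 'false' remains indistinguishable after the switch.
  blind⊨separating : _⊨_ (withObs frame blind) separating
  blind⊨separating noSuccessor =
    noSuccessor toTrue (λ _ → _) startsFalse (refl , knowsP-fails)
    where
    toTrue : ℕ → Bool
    toTrue zero    = false
    toTrue (suc _) = true

    startsFalse : ∀ i → i ≤ 0 → toTrue i ≡ false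
    startsFalse zero _ = refl

    knowsP-fails : ¬ sat (withObs frame blind) toTrue 1
                     (extend emptyRec agent (fsuc fzero) 1) (K agent (atom 0))
    knowsP-fails knows with knows (λ _ → false) (refl , λ _ _ → _) (λ _ _ _ _ → _)
    ... | ()

  -- In the sighted model, after switching to observation 1 the agent sees
  -- the current state, so p (when true) is known.
  sighted⊭separating : ¬ _⊨_ (withObs frame sighted) separating
  sighted⊭separating sat-sep = sat-sep λ π path agrees (p-holds , knowsP-fails) →
    knowsP-fails λ π' hist indist →
      subst (λ s → val s 0 ≡ true)
            (indist 1 (s≤s z≤n) (fsuc fzero) (there (here refl))) p-holds

  ¬CTLKΔ⪯CTLK : ¬ CTLKΔ⪯CTLK m k
  ¬CTLKΔ⪯CTLK =
    separation⇒¬CTLKΔ⪯CTLK (withObs frame blind) (withObs frame sighted) separating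
      (λ φ noΔ → transfer frame blind sighted blind-agrees-sighted φ noΔ _ 0)
      blind⊨separating sighted⊭separating

theorem33 : (m k : ℕ) → 1 ≤ m → 1 < k →
    CTLK⪯CTLKΔ m k × ¬ CTLKΔ⪯CTLK m k
theorem33 (suc m') (suc zero) _ (s≤s ())
theorem33 (suc m') (suc (suc k')) _ _ =
  CTLK⪯CTLKΔ-holds (suc m') (suc (suc k')) , TwoStates.¬CTLKΔ⪯CTLK m' k'
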